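{- Let $G=(V,E)$ be a finite simple graph and let $\pi=v_1,\dots,v_n$ be an ordering of $V$. Suppose that \textsc{FirstFit}, run on the online graph $(G,\pi)$, uses exactly $x$ distinct colors, where $x\ge 2$. Then there exist a set $V'\subseteq V$ and an integer $q$ with $0\le q\le x-2$ such that $|V'|=x+q$ and $V'$ can be partitioned into $q+1$ subsets, each of which has at least two vertices and is a clique in $G$ (all its vertices are pairwise adjacent).
   Context: An online graph $(G,\pi)$ is a graph $G$ together with an ordering $\pi=v_1,\dots,v_n$ of its vertices, in which the vertices are revealed one at a time; when $v_i$ is revealed, its adjacencies to $v_1,\dots,v_{i-1}$ become known, and an online coloring algorithm must irrevocably assign $v_i$ a color so that the coloring stays proper (adjacent vertices get different colors). \textsc{FirstFit} uses a totally ordered set of colors $c_0<c_1<c_2<\cdots$ and assigns to each arriving vertex the smallest color not already assigned to one of its previously revealed neighbors. -}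

module Defs where

open import Data.Nat using (ℕ; zero; suc)
open import Data.Nat.Properties using (_≟_)
open import Data.Bool using (Bool; true; false; if_then_else_)
open import Data.Fin using (Fin)
open import Data.Fin.Permutation using (Permutation′; _⟨$⟩ʳ_)
open import Data.List using (List; []; _∷_; _++_; [_]; map; filterᵇ; foldl; length; deduplicate; allFin)
open import Data.List.Membership.DecPropositional _≟_ using (_∈?_)
open import Data.Product using (_×_; _,_; proj₁; proj₂)
open import Relation.Nullary.Decidable using (does)
open import Relation.Binary.PropositionalEquality using (_≡_)
open import Relation.Nullary using (¬_)

record SimpleGraph (n : ℕ) : Set where
  field
    adj    : Fin n → Fin n → Bool
    sym    : ∀ u v → adj u v ≡ adj v u
    irrefl : ∀ v → adj v v ≡ false
open SimpleGraph public

-- Colors c₀ < c₁ < ⋯ are represented by natural numbers 0 < 1 < ⋯.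
-- firstFreeFrom fuel c l : the least c' ≥ c not in l (searching 'fuel' steps).
firstFreeFrom : ℕ → ℕ → List ℕ → ℕ
firstFreeFrom zero    c l = c
firstFreeFrom (suc f) c l = if does (c ∈? l) then firstFreeFrom f (suc c) l else c

-- smallest natural number not occurring in l (it is ≤ length l, so the fuel suffices)
smallestFree : List ℕ → ℕ
smallestFree l = firstFreeFrom (suc (length l)) 0 l

firstFitStep : ∀ {n} → SimpleGraph n → List (Fin n × ℕ) → Fin n → List (Fin n × ℕ)
firstFitStep G acc v =
  acc ++ [ (v , smallestFree (map proj₂ (filterᵇ (λ p → adj G (proj₁ p) v) acc))) ]

firstFitRun : ∀ {n} → SimpleGraph n → List (Fin n) → List (Fin n × ℕ)
firstFitRun G = foldl (firstFitStep G) []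

-- The ordering π = v₁,…,vₙ : the i-th revealed vertex is π ⟨$⟩ʳ i.
arrival : ∀ {n} → Permutation′ n → List (Fin n)
arrival π = map (π ⟨$⟩ʳ_) (allFin _)

numColorsFF : ∀ {n} → SimpleGraph n → Permutation′ n → ℕ
numColorsFF G π = length (deduplicate _≟_ (map proj₂ (firstFitRun G (arrival π))))

open import Data.List.Membership.Propositional using (_∈_)
IsClique : ∀ {n} → SimpleGraph n → List (Fin n) → Set
IsClique G B = ∀ {u v} → u ∈ B → v ∈ B → ¬ (u ≡ v) → adj G u v ≡ true

-- While k colors are in use, maintain disjoint cliques of
-- colored vertices, each of size at least 2, whose sizes minus one add up to k − 1.  A
-- vertex v that opens color k has a colored neighbor of every smaller color.  If one of
-- the cliques lies in the neighborhood of v, add v to it; otherwise some colored neighbor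
-- u of v lies outside all cliques, and {u, v} becomes a new clique.  For this dichotomy
-- to persist, the induction hypothesis is strengthened: for any family of vertex sets
-- each meeting all color classes, one packing of cliques serves every set of the
-- family, i.e. the set contains a whole clique or a colored vertex outside all cliques.
-- The neighborhood of v is then simply added to the family.  Finally, q + 1 cliques of
-- size ≥ 2 whose sizes add up to x + q force q ≤ x − 2.
module Submission where

open import Defs
open import Data.Nat using (ℕ; suc; _+_; _≤_; _∸_)
open import Data.Fin using (Fin)
open import Data.Fin.Permutation using (Permutation′)
open import Data.List using (List; length; concat)
open import Data.List.Relation.Unary.All using (All)
open import Data.List.Relation.Unary.Unique.Propositional using (Unique)
open import Data.Product using (Σ; _×_)
open import Relation.Binary.PropositionalEquality using (_≡_)

open import Data.Bool using (Bool; true; false)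
open import Data.Bool.Properties using (T-≡)
open import Data.Empty using (⊥)
open import Data.Maybe using (Maybe; just; nothing; maybe′)
open import Data.Nat using (zero; _<_; _*_; _≟_; z≤n; s≤s)
open import Data.Nat.Properties
  using (_≤?_; ≤-trans; ≤-reflexive; <⇒≤; <⇒≱; m≤n⇒m<n∨m≡n; ≰⇒>; m<n⇒m<1+n; n<1+n;
         +-mono-≤; +-suc; +-comm; +-cancelˡ-≤; m+n≤o⇒m≤o∸n; suc-injective; <-irrefl; module ≤-Reasoning)
open import Data.Nat.Tactic.RingSolver using (solve-∀)
open import Data.List using ([]; _∷_; _++_; [_]; map; filterᵇ; foldl; deduplicate; upTo)
open import Data.List.Properties using (length-upTo; length-++)
open import Data.List.Membership.Propositional using (_∈_; _∉_)
open import Data.List.Membership.Propositional.Properties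
  using (∈-deduplicate⁺; ∈-deduplicate⁻; ∈-upTo⁺; ∈-upTo⁻; ∈-map⁺; ∈-map⁻; ∈-++⁺ˡ; ∈-++⁺ʳ; ∈-++⁻; ∈-filter⁻; ∈-∃++)
open import Data.List.Membership.Propositional.Properties.WithK using (unique∧set⇒bag)
open import Data.List.Membership.DecPropositional _≟_ using (_∈?_)
open import Data.List.Relation.Binary.BagAndSetEquality using (∼bag⇒↭)
open import Data.List.Relation.Binary.Permutation.Propositional as ↭ using (_↭_; ↭-sym; ↭⇒↭ₛ)
open import Data.List.Relation.Binary.Permutation.Propositional.Properties
  using (↭-length; ∈-resp-↭; All-resp-↭; ++⁺ˡ; shift; shifts)
import Data.List.Relation.Binary.Permutation.Setoid.Properties as Permutationₛ
open import Data.List.Relation.Unary.All using ([]; _∷_)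
import Data.List.Relation.Unary.All as All
open import Data.List.Relation.Unary.All.Properties using (¬Any⇒All¬)
open import Data.List.Relation.Unary.AllPairs using ([]; _∷_)
open import Data.List.Relation.Unary.Any using (here; there)
open import Data.List.Relation.Unary.Unique.DecPropositional.Properties _≟_ using (deduplicate-!)
open import Data.List.Relation.Unary.Unique.Propositional.Properties using (upTo⁺; allFin⁺; map⁺)
open import Data.Product using (_,_; proj₁; proj₂; ∃-syntax)
import Data.Product as Product
open import Data.Sum using (_⊎_; inj₁; inj₂)
import Data.Sum as Sum
open import Function using (_∘_; _⇔_; mk⇔; Equivalence; Injection)
open import Function.Properties.Inverse using (↔⇒↣)
open import Relation.Binary.Definitions using (_Respects_)
open import Relation.Binary.PropositionalEquality using (refl; cong; subst; subst₂; setoid)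
import Relation.Binary.PropositionalEquality as ≡
open import Relation.Nullary using (¬_; yes; no; contradiction)

firstFreeFrom-minimal : ∀ f c l {d} → c ≤ d → d < firstFreeFrom f c l → d ∈ l
firstFreeFrom-minimal zero c l c≤d d<c = contradiction c≤d (<⇒≱ d<c)
firstFreeFrom-minimal (suc f) c l c≤d d<c′ with c ∈? l | m≤n⇒m<n∨m≡n c≤d
... | yes c∈l | inj₁ c<d  = firstFreeFrom-minimal f (suc c) l c<d d<c′
... | yes c∈l | inj₂ refl = c∈l
... | no _    | _         = contradiction c≤d (<⇒≱ d<c′)

smallestFree-minimal : ∀ l {d} → d < smallestFree l → d ∈ l
smallestFree-minimal l = firstFreeFrom-minimal (suc (length l)) 0 l z≤n

length-deduplicate-upTo : ∀ (l : List ℕ) k → (∀ {c} → c ∈ l ⇔ c < k) →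
  length (deduplicate _≟_ l) ≡ k
length-deduplicate-upTo l k l≈upTo = ≡.trans (↭-length dedup↭upTo) (length-upTo k)
  where
  same : ∀ {c} → c ∈ deduplicate _≟_ l ⇔ c ∈ upTo k
  same = mk⇔ (∈-upTo⁺ ∘ Equivalence.to l≈upTo ∘ ∈-deduplicate⁻ _≟_ l)
             (∈-deduplicate⁺ _≟_ ∘ Equivalence.from l≈upTo ∘ ∈-upTo⁻)
  dedup↭upTo : deduplicate _≟_ l ↭ upTo k
  dedup↭upTo = ∼bag⇒↭ (unique∧set⇒bag (deduplicate-! l) (upTo⁺ k) same)

∈-∷ʳ⁻ : ∀ {a} {A : Set a} {x y : A} xs → x ∈ xs ++ [ y ] → x ∈ xs ⊎ x ≡ y
∈-∷ʳ⁻ xs p = Sum.map₂ (λ { (here x≡y) → x≡y }) (∈-++⁻ xs p)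

module _ {a} {A : Set a} where

  concat⁺ : ∀ {xss yss : List (List A)} → xss ↭ yss → concat xss ↭ concat yss
  concat⁺ ↭.refl           = ↭.refl
  concat⁺ (↭.prep xs p)    = ++⁺ˡ xs (concat⁺ p)
  concat⁺ (↭.swap xs ys p) = ↭.trans (shifts xs ys) (++⁺ˡ ys (++⁺ˡ xs (concat⁺ p)))
  concat⁺ (↭.trans p q)    = ↭.trans (concat⁺ p) (concat⁺ q)

  Unique-resp-↭ : Unique {A = A} Respects _↭_
  Unique-resp-↭ p = Permutationₛ.Unique-resp-↭ (setoid A) (↭⇒↭ₛ p)

  length-concat-≥ : ∀ {m} (xss : List (List A)) → All (λ xs → m ≤ length xs) xss →
    length xss * m ≤ length (concat xss)
  length-concat-≥ []         []         = z≤n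
  length-concat-≥ (xs ∷ xss) (m≤ ∷ m≤s) = ≤-trans (+-mono-≤ m≤ (length-concat-≥ xss m≤s))
                                                   (≤-reflexive (≡.sym (length-++ xs)))

module _ {n} (G : SimpleGraph n) where

  singleton-isClique : ∀ v → IsClique G [ v ]
  singleton-isClique v (here refl) (here refl) v≢v = contradiction refl v≢v

  isClique-∷ : ∀ {v B} → IsClique G B → (∀ {u} → u ∈ B → adj G u v ≡ true) → IsClique G (v ∷ B)
  isClique-∷ B-clique v~B (here refl) (here refl) v≢v = contradiction refl v≢v
  isClique-∷ B-clique v~B (here refl) (there w∈B) _   = ≡.trans (sym G _ _) (v~B w∈B)
  isClique-∷ B-clique v~B (there u∈B) (here refl) _   = v~B u∈B
  isClique-∷ B-clique v~B (there u∈B) (there w∈B) u≢w = B-clique u∈B w∈B u≢w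

DisjointCliques : ∀ {n} → SimpleGraph n → ℕ → Set
DisjointCliques {n} G x = Σ ℕ (λ q → q ≤ x ∸ 2 ×
  Σ (List (List (Fin n))) (λ Bs →
    length Bs ≡ suc q ×
    Unique (concat Bs) ×
    length (concat Bs) ≡ x + q ×
    All (λ B → 2 ≤ length B × IsClique G B) Bs))

module FirstFitInvariant {n} (G : SimpleGraph n) where

  Coloring : Set
  Coloring = List (Fin n × ℕ)

  VertexSet : Set
  VertexSet = Fin n → Bool

  _⊆ᵥ_ : List (Fin n) → VertexSet → Set
  B ⊆ᵥ A = ∀ {u} → u ∈ B → A u ≡ true

  neighbors : Fin n → VertexSet
  neighbors v u = adj G u v

  Colored : Coloring → Fin n → Set
  Colored acc u = ∃[ c ] (u , c) ∈ acc

  Hits : Coloring → ℕ → VertexSet → Set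
  Hits acc k A = ∀ {c} → c < k → ∃[ u ] A u ≡ true × (u , c) ∈ acc

  Block : List (Fin n) → Set
  Block B = 2 ≤ length B × IsClique G B

  -- The excess equation says that the sizes of the blocks minus one add up to k − 1.
  record Packing (acc : Coloring) (k : ℕ) (Bs : List (List (Fin n))) : Set where
    field
      disjoint : Unique (concat Bs)
      colored  : ∀ {u} → u ∈ concat Bs → Colored acc u
      excess   : length (concat Bs) + 1 ≡ length Bs + k
  open Packing

  Served : Coloring → List (List (Fin n)) → VertexSet → Set
  Served acc Bs A = (∃[ u ] A u ≡ true × Colored acc u × u ∉ concat Bs)
                  ⊎ (∃[ B ] B ∈ Bs × B ⊆ᵥ A)

  PackingServing : Coloring → ℕ → {I : Set} → (I → VertexSet) → Set
  PackingServing acc k A = ∃[ Bs ] Packing acc k Bs × All Block Bs × (∀ i → Served acc Bs (A i))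

  Packable : Coloring → ℕ → Set₁
  Packable acc k = (I : Set) (A : I → VertexSet) → (∀ i → Hits acc k (A i)) → PackingServing acc k A

  record Invariant (acc : Coloring) (k : ℕ) : Set₁ where
    field
      colors-below : ∀ {u c} → (u , c) ∈ acc → c < k
      colors-used  : ∀ {c} → c < k → ∃[ u ] (u , c) ∈ acc
      packable     : Packable acc k
  open Invariant

  colored-++ : ∀ {acc x u} → Colored acc u → Colored (acc ++ [ x ]) u
  colored-++ (c , p) = c , ∈-++⁺ˡ p

  colored-last : ∀ acc {v c} → Colored (acc ++ [ (v , c) ]) v
  colored-last acc {c = c} = c , ∈-++⁺ʳ acc (here refl)

  Packing-++ : ∀ {acc x k Bs} → Packing acc k Bs → Packing (acc ++ [ x ]) k Bs
  Packing-++ P = record { disjoint = disjoint P ; colored = colored-++ ∘ colored P ; excess = excess P }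

  Served-++ : ∀ {acc x Bs A} → Served acc Bs A → Served (acc ++ [ x ]) Bs A
  Served-++ (inj₁ (u , u∈A , cu , u∉Bs)) = inj₁ (u , u∈A , colored-++ cu , u∉Bs)
  Served-++ (inj₂ B⊆A)                  = inj₂ B⊆A

  Packing-resp-↭ : ∀ {acc k Bs Cs} → Bs ↭ Cs → Packing acc k Bs → Packing acc k Cs
  Packing-resp-↭ {k = k} p P = record
    { disjoint = Unique-resp-↭ (concat⁺ p) (disjoint P)
    ; colored  = colored P ∘ ∈-resp-↭ (↭-sym (concat⁺ p))
    ; excess   = subst₂ (λ l b → l + 1 ≡ b + k) (↭-length (concat⁺ p)) (↭-length p) (excess P)
    }

  Served-resp-↭ : ∀ {acc Bs Cs A} → Bs ↭ Cs → Served acc Bs A → Served acc Cs A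
  Served-resp-↭ p (inj₁ (u , u∈A , cu , u∉Bs)) = inj₁ (u , u∈A , cu , u∉Bs ∘ ∈-resp-↭ (↭-sym (concat⁺ p)))
  Served-resp-↭ p (inj₂ (B , B∈Bs , B⊆A))     = inj₂ (B , ∈-resp-↭ p B∈Bs , B⊆A)

  Packing-seed : ∀ {acc k m Bs} → Colored acc m → m ∉ concat Bs → Packing acc k Bs →
    Packing acc k ([ m ] ∷ Bs)
  Packing-seed cm m∉Bs P = record
    { disjoint = ¬Any⇒All¬ _ m∉Bs ∷ disjoint P
    ; colored  = λ { (here refl) → cm ; (there u∈Bs) → colored P u∈Bs }
    ; excess   = cong suc (excess P)
    }

  Served-seed : ∀ {acc m Bs A} → Served acc Bs A → Served acc ([ m ] ∷ Bs) A
  Served-seed {m = m} (inj₁ (u , u∈A , cu , u∉Bs)) with u Data.Fin.≟ m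
  ... | yes refl = inj₂ ([ u ] , here refl , λ { (here refl) → u∈A })
  ... | no u≢m   = inj₁ (u , u∈A , cu , λ { (here u≡m) → u≢m u≡m ; (there u∈Bs) → u∉Bs u∈Bs })
  Served-seed (inj₂ (B , B∈Bs , B⊆A)) = inj₂ (B , there B∈Bs , B⊆A)

  Packing-grow : ∀ {acc k v B Bs} → ¬ Colored acc v → Packing acc k (B ∷ Bs) →
    Packing (acc ++ [ (v , k) ]) (suc k) ((v ∷ B) ∷ Bs)
  Packing-grow {acc} {k} v∉acc P = record
    { disjoint = ¬Any⇒All¬ _ (v∉acc ∘ colored P) ∷ disjoint P
    ; colored  = λ { (here refl) → colored-last acc ; (there u∈) → colored-++ (colored P u∈) }
    ; excess   = ≡.trans (cong suc (excess P)) (≡.sym (+-suc _ k))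
    }

  Served-grow : ∀ {acc c v B Bs A} → ¬ Colored acc v → A v ≡ true → Served acc (B ∷ Bs) A →
    Served (acc ++ [ (v , c) ]) ((v ∷ B) ∷ Bs) A
  Served-grow v∉acc v∈A (inj₁ (u , u∈A , cu , u∉Bs)) =
    inj₁ (u , u∈A , colored-++ cu , λ { (here refl) → v∉acc cu ; (there u∈) → u∉Bs u∈ })
  Served-grow v∉acc v∈A (inj₂ (B , here refl , B⊆A)) =
    inj₂ (_ , here refl , λ { (here refl) → v∈A ; (there u∈B) → B⊆A u∈B })
  Served-grow v∉acc v∈A (inj₂ (B , there B∈Bs , B⊆A)) = inj₂ (B , there B∈Bs , B⊆A)

  packable-oldColor : ∀ {acc k v s} → ¬ Colored acc v → Packable acc k → Packable (acc ++ [ (v , s) ]) k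
  packable-oldColor {acc} {k} {v} {s} v∉acc packable I A hits
    with packable (Σ I λ i → A i v ≡ false) (A ∘ proj₁) hits-acc
    where
    hits-acc : ∀ j → Hits acc k (A (proj₁ j))
    hits-acc (i , v∉A) c<k with hits i c<k
    ... | u , u∈A , p with ∈-∷ʳ⁻ acc p
    ...   | inj₁ q    = u , u∈A , q
    ...   | inj₂ refl = contradiction (≡.trans (≡.sym u∈A) v∉A) λ ()
  ... | Bs , P , blocks , served = Bs , Packing-++ P , blocks , served′
    where
    served′ : ∀ i → Served (acc ++ [ (v , s) ]) Bs (A i)
    served′ i with A i v in v∈A
    ... | true  = inj₁ (v , v∈A , colored-last acc , v∉acc ∘ colored P)
    ... | false = Served-++ (served (i , v∈A))

  -- Every set of the family contains v, the only vertex of color k.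
  packable-newColor : ∀ {acc k v} → (∀ {u c} → (u , c) ∈ acc → c < k) → ¬ Colored acc v →
    Hits acc k (neighbors v) → Packable acc k → Packable (acc ++ [ (v , k) ]) (suc k)
  packable-newColor {acc} {k} {v} below v∉acc v~all packable I A hits =
    extend (packable (Maybe I) (maybe′ A (neighbors v)) hits-acc)
    where
    hits-acc : ∀ j → Hits acc k (maybe′ A (neighbors v) j)
    hits-acc nothing  = v~all
    hits-acc (just i) c<k with hits i (m<n⇒m<1+n c<k)
    ... | u , u∈A , p with ∈-∷ʳ⁻ acc p
    ...   | inj₁ q    = u , u∈A , q
    ...   | inj₂ refl = contradiction c<k (<-irrefl refl)

    v∈A : ∀ i → A i v ≡ true
    v∈A i with hits i (n<1+n k)
    ... | u , u∈A , p with ∈-∷ʳ⁻ acc p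
    ...   | inj₁ q    = contradiction (below q) (<-irrefl refl)
    ...   | inj₂ refl = u∈A

    grow : ∀ {B Cs} → Packing acc k (B ∷ Cs) → 1 ≤ length B → IsClique G B → B ⊆ᵥ neighbors v →
      All Block Cs → (∀ i → Served acc (B ∷ Cs) (A i)) → PackingServing (acc ++ [ (v , k) ]) (suc k) A
    grow {B} {Cs} P 1≤B B-clique B⊆N blocks served =
      (v ∷ B) ∷ Cs , Packing-grow v∉acc P , (s≤s 1≤B , isClique-∷ G B-clique B⊆N) ∷ blocks ,
      λ i → Served-grow v∉acc (v∈A i) (served i)

    extend : PackingServing acc k (maybe′ A (neighbors v)) → PackingServing (acc ++ [ (v , k) ]) (suc k) A
    extend (Bs , P , blocks , served) with served nothing
    ... | inj₁ (m , m~v , cm , m∉Bs) =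
      grow (Packing-seed cm m∉Bs P) (s≤s z≤n) (singleton-isClique G m)
           (λ { (here refl) → m~v }) blocks (Served-seed ∘ served ∘ just)
    ... | inj₂ (B , B∈Bs , B⊆N) with ∈-∃++ B∈Bs
    ...   | ys , zs , refl with All-resp-↭ (shift B ys zs) blocks
    ...     | (2≤B , B-clique) ∷ blocks′ =
      grow (Packing-resp-↭ (shift B ys zs) P) (<⇒≤ 2≤B) B-clique B⊆N blocks′
           (Served-resp-↭ (shift B ys zs) ∘ served ∘ just)

  firstFitColor : Coloring → Fin n → ℕ
  firstFitColor acc v = smallestFree (map proj₂ (filterᵇ (λ p → adj G (proj₁ p) v) acc))

  firstFitColor-grundy : ∀ acc v → Hits acc (firstFitColor acc v) (neighbors v)
  firstFitColor-grundy acc v d<s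
    with ∈-map⁻ proj₂ (smallestFree-minimal (map proj₂ (filterᵇ (λ p → adj G (proj₁ p) v) acc)) d<s)
  ... | (u , d) , p , refl with ∈-filter⁻ _ {xs = acc} p
  ...   | q , u~v = u , Equivalence.to T-≡ u~v , q

  initial-invariant : ∀ v → Invariant [ (v , 0) ] 1
  initial-invariant v = record
    { colors-below = λ { (here refl) → s≤s z≤n }
    ; colors-used  = λ { (s≤s z≤n) → v , here refl }
    ; packable     = λ I A hits → [] , record { disjoint = [] ; colored = λ () ; excess = refl } , [] , served A hits
    }
    where
    served : ∀ {I} (A : I → VertexSet) → (∀ i → Hits [ (v , 0) ] 1 (A i)) → ∀ i → Served [ (v , 0) ] [] (A i)
    served A hits i with hits i (s≤s z≤n)
    ... | u , u∈A , here refl = inj₁ (u , u∈A , (0 , here refl) , λ ())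

  invariant-oldColor : ∀ {acc k v s} → ¬ Colored acc v → s < k → Invariant acc k → Invariant (acc ++ [ (v , s) ]) k
  invariant-oldColor {acc} v∉acc s<k inv = record
    { colors-below = λ p → Sum.[ colors-below inv , (λ { refl → s<k }) ] (∈-∷ʳ⁻ acc p)
    ; colors-used  = λ c<k → Product.map₂ ∈-++⁺ˡ (colors-used inv c<k)
    ; packable     = packable-oldColor v∉acc (packable inv)
    }

  invariant-newColor : ∀ {acc k v} → ¬ Colored acc v → Hits acc k (neighbors v) → Invariant acc k →
    Invariant (acc ++ [ (v , k) ]) (suc k)
  invariant-newColor {acc} {k} {v} v∉acc v~all inv = record
    { colors-below = λ p → Sum.[ m<n⇒m<1+n ∘ colors-below inv , (λ { refl → n<1+n k }) ] (∈-∷ʳ⁻ acc p)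
    ; colors-used  = used
    ; packable     = packable-newColor (colors-below inv) v∉acc v~all (packable inv)
    }
    where
    used : ∀ {c} → c < suc k → ∃[ u ] (u , c) ∈ acc ++ [ (v , k) ]
    used (s≤s c≤k) with m≤n⇒m<n∨m≡n c≤k
    ... | inj₁ c<k  = Product.map₂ ∈-++⁺ˡ (colors-used inv c<k)
    ... | inj₂ refl = v , ∈-++⁺ʳ acc (here refl)

  -- FirstFit opens at most one new color: color k would need a neighbor colored k.
  invariant-step : ∀ {acc k v} → ¬ Colored acc v → Invariant acc k →
    ∃[ k′ ] Invariant (acc ++ [ (v , firstFitColor acc v) ]) k′
  invariant-step {acc} {k} {v} v∉acc inv with firstFitColor acc v | firstFitColor-grundy acc v
  ... | s | v~below with s ≤? k
  ...   | no s≰k = contradiction (colors-below inv (proj₂ (proj₂ (v~below (≰⇒> s≰k))))) (<-irrefl refl)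
  ...   | yes s≤k with m≤n⇒m<n∨m≡n s≤k
  ...     | inj₁ s<k  = k , invariant-oldColor v∉acc s<k inv
  ...     | inj₂ refl = suc k , invariant-newColor v∉acc v~below inv

  invariant-run : ∀ {acc k} vs → Unique vs → (∀ {w} → w ∈ vs → ¬ Colored acc w) → Invariant acc k →
    ∃[ k′ ] Invariant (foldl (firstFitStep G) acc vs) k′
  invariant-run []       _              _     inv = _ , inv
  invariant-run {acc} (v ∷ vs) (v∉vs ∷ vs-unique) fresh inv with invariant-step (fresh (here refl)) inv
  ... | _ , inv′ = invariant-run vs vs-unique fresh′ inv′
    where
    fresh′ : ∀ {w} → w ∈ vs → ¬ Colored (firstFitStep G acc v) w
    fresh′ w∈vs (c , p) with ∈-∷ʳ⁻ acc p
    ... | inj₁ q    = fresh (there w∈vs) (c , q)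
    ... | inj₂ refl = All.lookup v∉vs w∈vs refl

  invariant-firstFitRun : ∀ v vs → Unique (v ∷ vs) → ∃[ k ] Invariant (firstFitRun G (v ∷ vs)) k
  invariant-firstFitRun v vs (v∉vs ∷ vs-unique) =
    invariant-run vs vs-unique (λ { w∈vs (_ , here refl) → All.lookup v∉vs w∈vs refl }) (initial-invariant v)

  numColors≡ : ∀ {acc k} → Invariant acc k → length (deduplicate _≟_ (map proj₂ acc)) ≡ k
  numColors≡ {acc} {k} inv = length-deduplicate-upTo (map proj₂ acc) k (mk⇔ below used)
    where
    below : ∀ {c} → c ∈ map proj₂ acc → c < k
    below p with ∈-map⁻ proj₂ p
    ... | _ , q , refl = colors-below inv q
    used : ∀ {c} → c < k → c ∈ map proj₂ acc
    used = ∈-map⁺ proj₂ ∘ proj₂ ∘ colors-used inv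

  packing⇒disjointCliques : ∀ {acc k Bs} → 2 ≤ k → Packing acc k Bs → All Block Bs → DisjointCliques G k
  packing⇒disjointCliques {Bs = []} 2≤k P [] = contradiction (subst (2 ≤_) (≡.sym (excess P)) 2≤k) λ { (s≤s ()) }
  packing⇒disjointCliques {k = k} {Bs = B ∷ Cs} 2≤k P blocks =
    q , m+n≤o⇒m≤o∸n q (+-cancelˡ-≤ q (q + 2) k bound) , B ∷ Cs , refl , disjoint P , size , blocks
    where
    q : ℕ
    q = length Cs
    size : length (concat (B ∷ Cs)) ≡ k + q
    size = suc-injective (≡.trans (+-comm 1 _) (≡.trans (excess P) (cong suc (+-comm q k))))
    twice : ∀ q → q + (q + 2) ≡ suc q * 2
    twice = solve-∀
    bound : q + (q + 2) ≤ q + k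
    bound = begin
      q + (q + 2)              ≡⟨ twice q ⟩
      suc q * 2                ≤⟨ length-concat-≥ (B ∷ Cs) (All.map proj₁ blocks) ⟩
      length (concat (B ∷ Cs)) ≡⟨ ≡.trans size (+-comm k q) ⟩
      q + k                    ∎
      where open ≤-Reasoning

  disjointCliques : ∀ {acc k} → 2 ≤ k → Invariant acc k → DisjointCliques G k
  disjointCliques 2≤k inv with packable inv ⊥ (λ ()) (λ ())
  ... | _ , P , blocks , _ = packing⇒disjointCliques 2≤k P blocks

open FirstFitInvariant using (invariant-firstFitRun; numColors≡; disjointCliques)

firstFitRun-disjointCliques : ∀ {n} (G : SimpleGraph n) vs → Unique vs →
  let x = length (deduplicate _≟_ (map proj₂ (firstFitRun G vs))) in
  2 ≤ x → DisjointCliques G x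
firstFitRun-disjointCliques G []       _          ()
firstFitRun-disjointCliques G (v ∷ vs) vs-unique 2≤x with invariant-firstFitRun G v vs vs-unique
... | _ , inv = subst (DisjointCliques G) (≡.sym (numColors≡ G inv))
                      (disjointCliques G (subst (2 ≤_) (numColors≡ G inv) 2≤x) inv)

arrival-unique : ∀ {n} (π : Permutation′ n) → Unique (arrival π)
arrival-unique π = map⁺ (Injection.injective (↔⇒↣ π)) (allFin⁺ _)

theorem1 : ∀ {n} (G : SimpleGraph n) (π : Permutation′ n) (x : ℕ) →
    numColorsFF G π ≡ x → 2 ≤ x →
    Σ ℕ (λ q → q ≤ x ∸ 2 ×
      Σ (List (List (Fin n))) (λ Bs →
        length Bs ≡ suc q ×
        Unique (concat Bs) ×
        length (concat Bs) ≡ x + q ×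
        All (λ B → 2 ≤ length B × IsClique G B) Bs))
theorem1 G π _ refl = firstFitRun-disjointCliques G (arrival π) (arrival-unique π)
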